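{- Let $n\ge 3$, let $D=\{d_1,\dots,d_t\}\subseteq\{0,1,\dots,n-1\}$ be nonempty, and let $k$ be an integer. Define $D+k=\{(d_i+k)\bmod n:1\le i\le t\}$. Then the unidirectional cycle $\overrightarrow{C_n}$ is $D$-antimagic if and only if it is $(D+k)$-antimagic.
   Context: The unidirectional cycle $\overrightarrow{C_n}$ has vertices $v_1,\dots,v_n$ and arcs $(v_i,v_{i+1})$ for $1\le i\le n-1$ and $(v_n,v_1)$, so $d(v_i,v_j)=(j-i)\bmod n$, where $d(u,y)$ is the length of a shortest directed path. $N_D(v)=\{y:d(v,y)\in D\}$; a bijection $f:V\to\{1,\dots,n\}$ is $D$-antimagic if $\omega_D(v)=\sum_{y\in N_D(v)}f(y)$ are pairwise distinct; the graph is $D$-antimagic if such a bijection exists. -}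

module Defs where

open import Data.Nat using (ℕ; zero; suc; _+_; _∸_; _%_; NonZero)
open import Data.Integer as ℤ using (ℤ; +_)
import Data.Integer.DivMod as ℤDM
open import Data.Fin using (Fin; toℕ; fromℕ<)
open import Data.Fin.Subset using (Subset; _∈_; Nonempty)
open import Data.Vec using (tabulate; lookup)
open import Data.Bool using (Bool; true; false; if_then_else_)
open import Data.List using (List; map; filterᵇ)
open import Data.Nat.ListAction using (sum)
open import Data.List using () renaming (allFin to allFinL)
open import Data.Nat.DivMod using (m%n<n)
open import Function.Bundles using (_⤖_; Bijection)
open import Function.Definitions using (Injective)
open import Relation.Binary.PropositionalEquality using (_≡_)

-- Vertices of the unidirectional cycle C⃗ₙ: v_{i+1} is represented by i : Fin n.
-- Distance d(v_i, v_j) = (j - i) mod n, computed as (j + n - i) mod n.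
dist : (n : ℕ) → .{{_ : NonZero n}} → Fin n → Fin n → Fin n
dist n u y = fromℕ< (m%n<n (toℕ y + n ∸ toℕ u) n)

memᵇ : {n : ℕ} → Subset n → Fin n → Bool
memᵇ D d = lookup D d

nbhd : (n : ℕ) → .{{_ : NonZero n}} → Subset n → Fin n → List (Fin n)
nbhd n D v = filterᵇ (λ y → memᵇ D (dist n v y)) (allFinL n)

-- Labels: f assigns the label toℕ (f v) + 1 ∈ {1,…,n}; f is a bijection Fin n ⤖ Fin n.
label : {n : ℕ} → (Fin n ⤖ Fin n) → Fin n → ℕ
label f v = suc (toℕ (Bijection.to f v))

weight : (n : ℕ) → .{{_ : NonZero n}} → Subset n → (Fin n ⤖ Fin n) → Fin n → ℕ
weight n D f v = sum (map (label f) (nbhd n D v))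

IsDAntimagicLabeling : (n : ℕ) → .{{_ : NonZero n}} → Subset n → (Fin n ⤖ Fin n) → Set
IsDAntimagicLabeling n D f = Injective _≡_ _≡_ (weight n D f)

record DAntimagic (n : ℕ) .{{nz : NonZero n}} (D : Subset n) : Set where
  constructor mkDAntimagic
  field
    labeling : Fin n ⤖ Fin n
    antimagic : IsDAntimagicLabeling n D labeling

addMod : (n : ℕ) → .{{_ : NonZero n}} → Fin n → ℤ → Fin n
addMod n d k = fromℕ< (ℤDM.n%d<d (+ toℕ d ℤ.+ k) (+ n))

-- D + k = { (d + k) mod n : d ∈ D }:  e ∈ D + k  iff  (e - k) mod n ∈ D.
shift : (n : ℕ) → .{{_ : NonZero n}} → Subset n → ℤ → Subset n
shift n D k = tabulate (λ e → memᵇ D (addMod n e (ℤ.- k)))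

-- Shifting every distance by k is the same as moving the base vertex by k:
-- N_{D+k}(v) = N_D(v + k), hence ω_{D+k} = ω_D ∘ (_+ k). Since v ↦ v + k is a
-- permutation of the vertices, a labeling is (D+k)-antimagic exactly when it is
-- D-antimagic, and shifting back by −k recovers D.
module Submission where

open import Defs
open import Data.Nat using (ℕ; _≥_; NonZero)
open import Data.Integer using (ℤ)
open import Data.Fin.Subset using (Subset; Nonempty)
open import Data.Product using (_×_)

open import Data.Bool using (T)
open import Data.Fin using (Fin; toℕ)
open import Data.Fin.Properties using (toℕ-fromℕ<; toℕ-injective; toℕ<n)
open import Data.Integer using (+_; 0ℤ; _+_; _-_; -_; _*_; ∣_∣; _⊖_; _%_; _/_)
import Data.Integer.DivMod as ℤ
import Data.Integer.Properties as ℤ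
open import Data.Integer.Divisibility.Signed using (_∣_; divides; ∣m∣n⇒∣m+n; ∣m⇒∣-m; ∣⇒∣ᵤ)
open import Data.Integer.Tactic.RingSolver using (solve-∀)
open import Data.List using (allFin; map)
open import Data.List.Properties using (filter-≐)
open import Data.Nat.ListAction using (sum)
import Data.Nat.Base as ℕ
import Data.Nat.Properties as ℕ
import Data.Nat.Divisibility as ℕ
open import Data.Product using (_,_)
open import Data.Vec using (lookup; tabulate)
open import Data.Vec.Properties using (lookup∘tabulate; tabulate-cong; tabulate∘lookup)
open import Function.Definitions using (Injective)
open import Level using (0ℓ)
open import Relation.Binary.Bundles using (Setoid)
open import Relation.Binary.Structures using (IsEquivalence)
open import Relation.Binary.PropositionalEquality
open import Relation.Nullary using (contradiction)

infix 4 _≡_mod_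

record _≡_mod_ (a b : ℤ) (n : ℕ) : Set where
  constructor n∣a-b⇒≡-mod
  field
    n∣a-b : + n ∣ a - b

module _ {n : ℕ} where

  ≡⇒≡-mod : ∀ {a b} → a ≡ b → a ≡ b mod n
  ≡⇒≡-mod {a} refl = n∣a-b⇒≡-mod (divides 0ℤ (ℤ.+-inverseʳ a))

  ≡-mod-sym : ∀ {a b} → a ≡ b mod n → b ≡ a mod n
  ≡-mod-sym {a} {b} (n∣a-b⇒≡-mod n∣a-b) =
    n∣a-b⇒≡-mod (subst (+ n ∣_) (neg-difference a b) (∣m⇒∣-m n∣a-b))
    where
    neg-difference : ∀ a b → - (a - b) ≡ b - a
    neg-difference = solve-∀

  ≡-mod-trans : ∀ {a b c} → a ≡ b mod n → b ≡ c mod n → a ≡ c mod n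
  ≡-mod-trans {a} {b} {c} (n∣a-b⇒≡-mod n∣a-b) (n∣a-b⇒≡-mod n∣b-c) =
    n∣a-b⇒≡-mod (subst (+ n ∣_) (telescope a b c) (∣m∣n⇒∣m+n n∣a-b n∣b-c))
    where
    telescope : ∀ a b c → (a - b) + (b - c) ≡ a - c
    telescope = solve-∀

  ≡-mod-isEquivalence : IsEquivalence (λ a b → a ≡ b mod n)
  ≡-mod-isEquivalence = record
    { refl  = ≡⇒≡-mod refl
    ; sym   = ≡-mod-sym
    ; trans = ≡-mod-trans
    }

  +-congʳ-mod : ∀ {a b} c → a ≡ b mod n → a + c ≡ b + c mod n
  +-congʳ-mod {a} {b} c (n∣a-b⇒≡-mod n∣a-b) =
    n∣a-b⇒≡-mod (subst (+ n ∣_) (difference a b c) n∣a-b)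
    where
    difference : ∀ a b c → a - b ≡ (a + c) - (b + c)
    difference = solve-∀

  +-congˡ-mod : ∀ c {a b} → a ≡ b mod n → c + a ≡ c + b mod n
  +-congˡ-mod c {a} {b} (n∣a-b⇒≡-mod n∣a-b) =
    n∣a-b⇒≡-mod (subst (+ n ∣_) (difference a b c) n∣a-b)
    where
    difference : ∀ a b c → a - b ≡ (c + a) - (c + b)
    difference = solve-∀

  -‿cong-mod : ∀ {a b} → a ≡ b mod n → - a ≡ - b mod n
  -‿cong-mod {a} {b} (n∣a-b⇒≡-mod n∣a-b) =
    n∣a-b⇒≡-mod (subst (+ n ∣_) (neg-difference a b) (∣m⇒∣-m n∣a-b))
    where
    neg-difference : ∀ a b → - (a - b) ≡ - a - - b
    neg-difference = solve-∀

  a+qn≡a-mod : ∀ a q → a + q * + n ≡ a mod n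
  a+qn≡a-mod a q = n∣a-b⇒≡-mod (divides q (cancel a q (+ n)))
    where
    cancel : ∀ a q m → (a + q * m) - a ≡ q * m
    cancel = solve-∀

  a%n≡a-mod : ∀ a .{{_ : NonZero n}} → + (a % + n) ≡ a mod n
  a%n≡a-mod a = ≡-mod-sym (subst (_≡ + (a % + n) mod n)
    (sym (ℤ.a≡a%n+[a/n]*n a (+ n))) (a+qn≡a-mod (+ (a % + n)) (a / + n)))

≡-mod-setoid : ℕ → Setoid 0ℓ 0ℓ
≡-mod-setoid n = record { isEquivalence = ≡-mod-isEquivalence {n} }

∣∧<⇒≡0 : ∀ {m x} → m ℕ.∣ x → x ℕ.< m → x ≡ 0
∣∧<⇒≡0 {x = ℕ.zero}  _   _   = refl
∣∧<⇒≡0 {x = ℕ.suc _} m∣x x<m = contradiction m∣x (ℕ.>⇒∤ x<m)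

≡-mod⇒≡ : ∀ {n r s} → r ℕ.< n → s ℕ.< n → + r ≡ + s mod n → r ≡ s
≡-mod⇒≡ {n} {r} {s} r<n s<n (n∣a-b⇒≡-mod n∣r-s) =
  ℤ.+-injective (ℤ.i-j≡0⇒i≡j (+ r) (+ s) (ℤ.∣i∣≡0⇒i≡0 (∣∧<⇒≡0 (∣⇒∣ᵤ n∣r-s) ∣r-s∣<n)))
  where
  ∣r-s∣<n : ∣ + r - + s ∣ ℕ.< n
  ∣r-s∣<n = subst (ℕ._< n) (cong ∣_∣ (sym (ℤ.[+m]-[+n]≡m⊖n r s)))
    (ℕ.≤-<-trans (ℤ.∣m⊝n∣≤m⊔n r s) (ℕ.⊔-pres-<m r<n s<n))

module _ {n : ℕ} .{{_ : NonZero n}} where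

  open import Relation.Binary.Reasoning.Setoid (≡-mod-setoid n)

  toℕ-≡-mod⇒≡ : ∀ {x y : Fin n} → + toℕ x ≡ + toℕ y mod n → x ≡ y
  toℕ-≡-mod⇒≡ {x} {y} x≡y = toℕ-injective (≡-mod⇒≡ (toℕ<n x) (toℕ<n y) x≡y)

  addMod-≡-mod : ∀ d k → + toℕ (addMod n d k) ≡ + toℕ d + k mod n
  addMod-≡-mod d k = begin
    + toℕ (addMod n d k)      ≡⟨ cong +_ (toℕ-fromℕ< _) ⟩
    + ((+ toℕ d + k) % + n)   ≈⟨ a%n≡a-mod (+ toℕ d + k) ⟩
    + toℕ d + k               ∎

  dist-≡-mod : ∀ u y → + toℕ (dist n u y) ≡ + toℕ y - + toℕ u mod n
  dist-≡-mod u y = begin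
    + toℕ (dist n u y)                  ≡⟨ cong +_ (toℕ-fromℕ< _) ⟩
    + ((toℕ y ℕ.+ n ℕ.∸ toℕ u) ℕ.% n)   ≈⟨ a%n≡a-mod (+ (toℕ y ℕ.+ n ℕ.∸ toℕ u)) ⟩
    + (toℕ y ℕ.+ n ℕ.∸ toℕ u)           ≡⟨ ℤ.⊖-≥ u≤y+n ⟨
    (toℕ y ℕ.+ n) ⊖ toℕ u               ≡⟨ ℤ.[+m]-[+n]≡m⊖n (toℕ y ℕ.+ n) (toℕ u) ⟨
    + (toℕ y ℕ.+ n) - + toℕ u           ≡⟨ cong (_- + toℕ u) (ℤ.pos-+ (toℕ y) n) ⟩
    (+ toℕ y + + n) - + toℕ u           ≡⟨ add-one-period (+ toℕ y) (+ toℕ u) (+ n) ⟩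
    (+ toℕ y - + toℕ u) + + 1 * + n     ≈⟨ a+qn≡a-mod (+ toℕ y - + toℕ u) (+ 1) ⟩
    + toℕ y - + toℕ u                   ∎
    where
    u≤y+n : toℕ u ℕ.≤ toℕ y ℕ.+ n
    u≤y+n = ℕ.≤-trans (ℕ.<⇒≤ (toℕ<n u)) (ℕ.m≤n+m n (toℕ y))
    add-one-period : ∀ y u m → (y + m) - u ≡ (y - u) + + 1 * m
    add-one-period = solve-∀

  addMod-cancel : ∀ v j k → j + k ≡ 0ℤ → addMod n (addMod n v j) k ≡ v
  addMod-cancel v j k j+k≡0 = toℕ-≡-mod⇒≡ (begin
    + toℕ (addMod n (addMod n v j) k) ≈⟨ addMod-≡-mod (addMod n v j) k ⟩
    + toℕ (addMod n v j) + k          ≈⟨ +-congʳ-mod k (addMod-≡-mod v j) ⟩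
    (+ toℕ v + j) + k                 ≡⟨ ℤ.+-assoc (+ toℕ v) j k ⟩
    + toℕ v + (j + k)                 ≡⟨ cong (λ c → + toℕ v + c) j+k≡0 ⟩
    + toℕ v + 0ℤ                      ≡⟨ ℤ.+-identityʳ (+ toℕ v) ⟩
    + toℕ v                           ∎)

  addMod-injective : ∀ k → Injective _≡_ _≡_ (λ v → addMod n v k)
  addMod-injective k {u} {v} u+k≡v+k =
    trans (sym (undo u)) (trans (cong (λ w → addMod n w (- k)) u+k≡v+k) (undo v))
    where
    undo : ∀ w → addMod n (addMod n w k) (- k) ≡ w
    undo w = addMod-cancel w k (- k) (ℤ.+-inverseʳ k)

  addMod-dist : ∀ k v y → addMod n (dist n v y) (- k) ≡ dist n (addMod n v k) y
  addMod-dist k v y = toℕ-≡-mod⇒≡ (begin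
    + toℕ (addMod n (dist n v y) (- k)) ≈⟨ addMod-≡-mod (dist n v y) (- k) ⟩
    + toℕ (dist n v y) - k              ≈⟨ +-congʳ-mod (- k) (dist-≡-mod v y) ⟩
    (+ toℕ y - + toℕ v) - k             ≡⟨ reassociate (+ toℕ y) (+ toℕ v) k ⟩
    + toℕ y - (+ toℕ v + k)             ≈⟨ +-congˡ-mod (+ toℕ y) (-‿cong-mod (addMod-≡-mod v k)) ⟨
    + toℕ y - + toℕ (addMod n v k)      ≈⟨ dist-≡-mod (addMod n v k) y ⟨
    + toℕ (dist n (addMod n v k) y)     ∎)
    where
    reassociate : ∀ y v k → (y - v) - k ≡ y - (v + k)
    reassociate = solve-∀

module _ {n : ℕ} .{{_ : NonZero n}} where

  open ≡-Reasoning

  lookup-shift : ∀ D k e → lookup (shift n D k) e ≡ lookup D (addMod n e (- k))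
  lookup-shift D k = lookup∘tabulate (λ e → memᵇ D (addMod n e (- k)))

  shift-neg-shift : ∀ D k → shift n (shift n D k) (- k) ≡ D
  shift-neg-shift D k = begin
    tabulate (λ e → lookup (shift n D k) (addMod n e (- - k)))
      ≡⟨ tabulate-cong (λ e → trans (lookup-shift D k _) (cong (lookup D) (undo e))) ⟩
    tabulate (lookup D)
      ≡⟨ tabulate∘lookup D ⟩
    D ∎
    where
    undo : ∀ e → addMod n (addMod n e (- - k)) (- k) ≡ e
    undo e = addMod-cancel e (- - k) (- k) (ℤ.+-inverseˡ (- k))

  nbhd-shift : ∀ D k v → nbhd n (shift n D k) v ≡ nbhd n D (addMod n v k)
  nbhd-shift D k v =
    filter-≐ _ _ ((λ {y} → subst T (same y)) , (λ {y} → subst T (sym (same y)))) (allFin n)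
    where
    same : ∀ y → memᵇ (shift n D k) (dist n v y) ≡ memᵇ D (dist n (addMod n v k) y)
    same y = trans (lookup-shift D k (dist n v y)) (cong (lookup D) (addMod-dist k v y))

  weight-shift : ∀ D k f v → weight n (shift n D k) f v ≡ weight n D f (addMod n v k)
  weight-shift D k f v = cong (λ N → sum (map (label f) N)) (nbhd-shift D k v)

  antimagic-shift : ∀ D k → DAntimagic n D → DAntimagic n (shift n D k)
  antimagic-shift D k (mkDAntimagic f ω-injective) = mkDAntimagic f λ {u} {v} ωu≡ωv →
    addMod-injective k (ω-injective (begin
      weight n D f (addMod n u k)         ≡⟨ weight-shift D k f u ⟨
      weight n (shift n D k) f u          ≡⟨ ωu≡ωv ⟩
      weight n (shift n D k) f v          ≡⟨ weight-shift D k f v ⟩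
      weight n D f (addMod n v k)         ∎))

-- The hypotheses n ≥ 3 and D ≠ ∅ are unused: the argument works for every n ≥ 1 and every D.
mainTheorem9 : (n : ℕ) → .{{nz : NonZero n}} → n ≥ 3 → (D : Subset n) → Nonempty D → (k : ℤ)
    → (DAntimagic n D → DAntimagic n (shift n D k)) × (DAntimagic n (shift n D k) → DAntimagic n D)
mainTheorem9 n _ D _ k =
  antimagic-shift D k ,
  λ antimagic-D+k → subst (DAntimagic n) (shift-neg-shift D k) (antimagic-shift (shift n D k) (- k) antimagic-D+k)
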